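{- Let $X$ be a connected graph. Then (1) $L(X'')$ is disconnected if and only if $X$ is bipartite; (2) $2t'=t_2+t_3$, where $t'$, $t_2$, $t_3$ denote the number of triangles in $L(X)$, $\gamma(X)$ and $L(X'')$, respectively.
   Context: All graphs are finite, without loops or multiple edges. $L(X)$ is the line graph of $X$. $X''$ denotes the Kronecker product $X\times K_2$: vertex set $V(X)\times\{0,1\}$, with $(x,a)$ adjacent to $(y,b)$ iff $xy\in E(X)$ and $a\neq b$. For a graph $X$ with $m$ edges, orient each edge arbitrarily and label the oriented edges $e_1,\dots,e_m$; put $e_{m+i}=e_i^{ -1}$ ($e_i$ reversed), and write $s(e),t(e)$ for starting and terminal vertices. The edge adjacency matrix $M$ is the $2m\times 2m$ matrix with $M_{ij}=1$ if $t(e_i)=s(e_j)$ and $s(e_i)\neq t(e_j)$, and $0$ otherwise; $\gamma(X)$ is the graph on vertices $e_1,\dots,e_{2m}$ with adjacency matrix $M+M^T$ (equivalently: vertices are ordered pairs $(u,v)$ with $uv\in E(X)$, and $(u,v)\sim(x,y)$ iff ($v=x$ and $y\neq u$) or ($y=u$ and $x\neq v$)). -}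

module Defs where

open import Data.Nat using (ℕ)
open import Data.Bool using (Bool; true; false; _∧_; _∨_; not; _xor_)
open import Data.Bool.Properties using () renaming (_≟_ to _≟B_)
open import Data.Fin using (Fin)
open import Data.Fin.Properties using () renaming (_≟_ to _≟F_)
open import Data.List using (List; []; _∷_; map; _++_; length; filterᵇ; allFin; cartesianProduct)
open import Data.List.Membership.Propositional using (_∈_)
open import Data.Product using (Σ; ∃; _×_; _,_)
open import Data.Product.Properties using (≡-dec)
open import Relation.Binary.Definitions using (DecidableEquality)
open import Relation.Binary.PropositionalEquality using (_≡_; _≢_)
open import Relation.Nullary.Decidable using (⌊_⌋)

-- A finite graph: the vertex set is the list `verts` (duplicate-free in all
-- our constructions) of elements of a type V with decidable equality;
-- `adj` is the (Boolean) adjacency relation.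
record Graph : Set₁ where
  constructor mkG
  field
    V     : Set
    _≟V_  : DecidableEquality V
    verts : List V
    adj   : V → V → Bool
open Graph public

pairs : {A : Set} → List A → List (A × A)
pairs []       = []
pairs (x ∷ xs) = map (x ,_) xs ++ pairs xs

triples : {A : Set} → List A → List (A × A × A)
triples []       = []
triples (x ∷ xs) = map (λ { (y , z) → (x , y , z) }) (pairs xs) ++ triples xs

triangles : Graph → ℕ
triangles G = length (filterᵇ isTri (triples (verts G)))
  where
  isTri : V G × V G × V G → Bool
  isTri (a , b , c) = adj G a b ∧ adj G a c ∧ adj G b c

data Reachable (G : Graph) : V G → V G → Set where
  here : ∀ {u} → Reachable G u u
  step : ∀ {u w v} → adj G u w ≡ true → w ∈ verts G → Reachable G w v → Reachable G u v

Connected : Graph → Set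
Connected G = (∃ λ v → v ∈ verts G)
            × (∀ u v → u ∈ verts G → v ∈ verts G → Reachable G u v)

Bipartite : Graph → Set
Bipartite G = ∃ λ (c : V G → Bool) →
  ∀ u v → u ∈ verts G → v ∈ verts G → adj G u v ≡ true → c u ≢ c v

finGraph : (n : ℕ) → (Fin n → Fin n → Bool) → Graph
finGraph n a = mkG (Fin n) _≟F_ (allFin n) a

-- line graph: vertices are the edges {a,b} (one representative pair each),
-- two edges adjacent iff distinct and sharing an endpoint
L : Graph → Graph
L G = mkG (V G × V G) (≡-dec _≟_ _≟_)
          (filterᵇ (λ { (a , b) → adj G a b }) (pairs (verts G)))
          ladj
  where
  _≟_ = _≟V_ G
  eq : V G → V G → Bool
  eq x y = ⌊ x ≟ y ⌋
  ladj : V G × V G → V G × V G → Bool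
  ladj (a , b) (c , d) =
    not ((eq a c ∧ eq b d) ∨ (eq a d ∧ eq b c))
    ∧ (eq a c ∨ eq a d ∨ eq b c ∨ eq b d)

-- Kronecker product X × K₂
_″ : Graph → Graph
G ″ = mkG (V G × Bool) (≡-dec (_≟V_ G) _≟B_)
          (cartesianProduct (verts G) (false ∷ true ∷ []))
          (λ { (x , a) (y , b) → adj G x y ∧ (a xor b) })

γ : Graph → Graph
γ G = mkG (V G × V G) (≡-dec _≟_ _≟_)
          (filterᵇ (λ { (a , b) → adj G a b }) (cartesianProduct (verts G) (verts G)))
          gadj
  where
  _≟_ = _≟V_ G
  eq : V G → V G → Bool
  eq x y = ⌊ x ≟ y ⌋
  gadj : V G × V G → V G × V G → Bool
  gadj (u , v) (x , y) = (eq v x ∧ not (eq y u)) ∨ (eq y u ∧ not (eq x v))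

-- A triangle of L(X) is either a star (three edges at one vertex) or the edge set of a triangle of X.
-- Each triangle of X gives two triangles of γ(X), its two cyclic orientations, while stars give none;
-- each star of X lifts to two stars of the bipartite double cover X″ and triangles lift to nothing.
-- Summing over ordered triples of darts, (2) thus reduces to an identity about six vertices which
-- depends only on which of them coincide, and is checked on all equality patterns.
-- For (1): if c is a proper 2-colouring of X, the value c(x) xor s at an endpoint (x,s) is the same
-- for all edges in a component of L(X″), and flipping s maps an edge to one with the other value.
-- Conversely, if (v₀,1) cannot be reached from (v₀,0) in X″, the parity of walks from v₀ is a proper
-- 2-colouring of X; otherwise X″, and hence L(X″), is connected.
module Submission where

open import Defs
open import Data.Nat using (ℕ; _*_; _+_)
open import Data.Bool using (Bool; true; false)
open import Data.Fin using (Fin)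
open import Data.Product using (_×_)
open import Function.Bundles using (_⇔_)
open import Relation.Nullary using (¬_)
open import Relation.Binary.PropositionalEquality using (_≡_)

open import Algebra.Bundles using (CommutativeMonoid)
open import Data.Bool using (_∧_; _∨_; not; _xor_; if_then_else_; T?)
open import Data.Bool.Properties
  using (∧-comm; ∧-inverseʳ; ∧-zeroʳ; ∧-conicalˡ; ∧-conicalʳ; ∨-assoc; ∨-comm; T-≡; not-involutive;
         not-¬; ¬-not; xor-comm; xor-same; xor-assoc; xor-identityʳ; not-distribˡ-xor; not-distribʳ-xor;
         ∧-commutativeMonoid; ∨-commutativeMonoid)
  renaming (_≟_ to _≟𝔹_)
open import Algebra.Properties.CommutativeSemigroup (CommutativeMonoid.commutativeSemigroup ∧-commutativeMonoid)
  using () renaming (x∙yz≈y∙xz to ∧-left-comm)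
open import Algebra.Properties.CommutativeSemigroup (CommutativeMonoid.commutativeSemigroup ∨-commutativeMonoid)
  using () renaming (x∙yz≈y∙xz to ∨-left-comm)
open import Data.Fin using (toℕ; #_; zero; suc)
open import Data.Fin.Properties using (all?) renaming (_≟_ to _≟ᶠ_)
open import Data.List using (List; []; _∷_; _++_; map; length; filterᵇ; cartesianProduct)
open import Data.List.Membership.Propositional using (_∈_; _∉_)
open import Data.List.Membership.Propositional.Properties
  using (∈-filter⁻; ∈-filter⁺; ∈-map⁺; ∈-map⁻; ∈-++⁺ˡ; ∈-++⁺ʳ; ∈-++⁻;
         ∈-cartesianProduct⁺; ∈-cartesianProduct⁻)
import Data.List.Membership.DecPropositional as DecMembership
open import Data.List.Relation.Unary.Any using (here; there)
open import Data.List.Relation.Unary.All as All using (All; []; _∷_)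
open import Data.List.Relation.Unary.AllPairs using ([]; _∷_)
open import Data.List.Relation.Unary.Unique.Propositional using (Unique)
open import Data.List.Relation.Unary.Unique.Propositional.Properties using (cartesianProduct⁺; allFin⁺)
open import Data.Nat using (suc; zero; _≤_; z≤n; s≤s)
open import Data.Nat.Properties
  using (_≟_; _≤?_; +-assoc; +-identityʳ; *-assoc; *-identityˡ; *-distribˡ-+; *-zeroʳ; *-cancelˡ-≡)
open import Data.Nat.Tactic.RingSolver using (solve-∀)
open import Data.Product using (Σ; ∃; _,_; proj₁; proj₂; swap; uncurry)
import Data.Product as Product
open import Data.Product.Properties using (≡-dec; ,-injective)
open import Data.Sum using (_⊎_; inj₁; inj₂)
import Data.Sum as Sum
open import Data.Vec using ([]; _∷_)
import Data.Vec as Vec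
open import Function.Base using (_∘_)
open import Function.Bundles using (Equivalence; mk⇔)
open import Relation.Binary.Definitions using (DecidableEquality)
open import Relation.Binary.PropositionalEquality
  using (_≢_; refl; sym; trans; cong; cong₂; subst; subst₂; module ≡-Reasoning)
open import Relation.Nullary.Decidable
  using (Dec; yes; no; does; ⌊_⌋; isYes≗does; dec-true; does-⇔; toWitness; fromWitness; from-yes;
         ¬?; _×-dec_; _⊎-dec_; _→-dec_)
open import Relation.Nullary.Negation using (contradiction)

private variable
  A B C : Set

-- Finite sums

𝟙 : Bool → ℕ
𝟙 true  = 1
𝟙 false = 0

∑ : List A → (A → ℕ) → ℕ
∑ []       f = 0
∑ (x ∷ xs) f = f x + ∑ xs f

infix 6.5 ∑
syntax ∑ xs (λ x → e) = ∑[ x ∈ xs ] e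

∑³ : List A → (A → A → A → ℕ) → ℕ
∑³ xs h = ∑[ a ∈ xs ] ∑[ b ∈ xs ] ∑[ c ∈ xs ] h a b c

∑-cong-∈ : ∀ (xs : List A) {f g : A → ℕ} → (∀ {x} → x ∈ xs → f x ≡ g x) → ∑ xs f ≡ ∑ xs g
∑-cong-∈ []       eq = refl
∑-cong-∈ (x ∷ xs) eq = cong₂ _+_ (eq (here refl)) (∑-cong-∈ xs (eq ∘ there))

∑-cong : ∀ (xs : List A) {f g : A → ℕ} → (∀ x → f x ≡ g x) → ∑ xs f ≡ ∑ xs g
∑-cong xs eq = ∑-cong-∈ xs (λ {x} _ → eq x)

∑-zero : ∀ (xs : List A) → ∑[ x ∈ xs ] 0 ≡ 0
∑-zero []       = refl
∑-zero (x ∷ xs) = ∑-zero xs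

∑-const : ∀ (xs : List A) n → ∑[ _ ∈ xs ] n ≡ length xs * n
∑-const []       n = refl
∑-const (x ∷ xs) n = cong (n +_) (∑-const xs n)

∑-distrib-+ : ∀ (xs : List A) (f g : A → ℕ) → ∑[ x ∈ xs ] (f x + g x) ≡ ∑ xs f + ∑ xs g
∑-distrib-+ []       f g = refl
∑-distrib-+ (x ∷ xs) f g = trans (cong (f x + g x +_) (∑-distrib-+ xs f g)) (interchange (f x) (g x) _ _)
  where
  interchange : ∀ a b c d → a + b + (c + d) ≡ a + c + (b + d)
  interchange = solve-∀

*-distribˡ-∑ : ∀ k (xs : List A) (f : A → ℕ) → k * ∑ xs f ≡ ∑[ x ∈ xs ] k * f x
*-distribˡ-∑ k []       f = *-zeroʳ k
*-distribˡ-∑ k (x ∷ xs) f = trans (*-distribˡ-+ k (f x) _) (cong (k * f x +_) (*-distribˡ-∑ k xs f))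

∑-++ : ∀ (xs ys : List A) (f : A → ℕ) → ∑ (xs ++ ys) f ≡ ∑ xs f + ∑ ys f
∑-++ []       ys f = refl
∑-++ (x ∷ xs) ys f = trans (cong (f x +_) (∑-++ xs ys f)) (sym (+-assoc (f x) _ _))

∑-map : ∀ (g : A → B) (xs : List A) (f : B → ℕ) → ∑ (map g xs) f ≡ ∑ xs (f ∘ g)
∑-map g []       f = refl
∑-map g (x ∷ xs) f = cong (f (g x) +_) (∑-map g xs f)

∑-comm : ∀ (xs : List A) (ys : List B) (f : A → B → ℕ)
       → ∑[ a ∈ xs ] ∑[ b ∈ ys ] f a b ≡ ∑[ b ∈ ys ] ∑[ a ∈ xs ] f a b
∑-comm []       ys f = sym (∑-zero ys)
∑-comm (x ∷ xs) ys f = trans (cong (∑ ys (f x) +_) (∑-comm xs ys f)) (sym (∑-distrib-+ ys (f x) _))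

∑-cartesianProduct : ∀ (xs : List A) (ys : List B) (f : A × B → ℕ)
                   → ∑ (cartesianProduct xs ys) f ≡ ∑[ a ∈ xs ] ∑[ b ∈ ys ] f (a , b)
∑-cartesianProduct []       ys f = refl
∑-cartesianProduct (x ∷ xs) ys f =
  trans (∑-++ (map (x ,_) ys) _ f) (cong₂ _+_ (∑-map (x ,_) ys f) (∑-cartesianProduct xs ys f))

∑-filterᵇ : ∀ (p : A → Bool) (xs : List A) (f : A → ℕ)
          → ∑ (filterᵇ p xs) f ≡ ∑[ x ∈ xs ] (if p x then f x else 0)
∑-filterᵇ p []       f = refl
∑-filterᵇ p (x ∷ xs) f with p x
... | true  = cong (f x +_) (∑-filterᵇ p xs f)
... | false = ∑-filterᵇ p xs f

if-∑ : ∀ b (xs : List A) (f : A → ℕ) → (if b then ∑ xs f else 0) ≡ ∑[ x ∈ xs ] (if b then f x else 0)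
if-∑ true  xs f = refl
if-∑ false xs f = sym (∑-zero xs)

length-filterᵇ : ∀ (p : A → Bool) (xs : List A) → length (filterᵇ p xs) ≡ ∑[ x ∈ xs ] 𝟙 (p x)
length-filterᵇ p []       = refl
length-filterᵇ p (x ∷ xs) with p x
... | true  = cong (1 +_) (length-filterᵇ p xs)
... | false = length-filterᵇ p xs

∑²-pairs : ∀ (xs : List A) (g : A → A → ℕ) → (∀ a → g a a ≡ 0)
         → ∑[ a ∈ xs ] ∑[ b ∈ xs ] g a b ≡ ∑ (pairs xs) (λ (a , b) → g a b + g b a)
∑²-pairs []       g diag = refl
∑²-pairs (x ∷ xs) g diag = begin
  g x x + ∑ xs (g x) + ∑[ a ∈ xs ] (g a x + ∑ xs (g a))
    ≡⟨ cong₂ (λ u v → u + ∑ xs (g x) + v) (diag x) (∑-distrib-+ xs (λ a → g a x) _) ⟩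
  ∑ xs (g x) + (∑[ a ∈ xs ] g a x + ∑[ a ∈ xs ] ∑ xs (g a))
    ≡⟨ cong (λ v → ∑ xs (g x) + (∑[ a ∈ xs ] g a x + v)) (∑²-pairs xs g diag) ⟩
  ∑ xs (g x) + (∑[ a ∈ xs ] g a x + P)
    ≡⟨ sym (+-assoc (∑ xs (g x)) _ P) ⟩
  ∑ xs (g x) + ∑[ a ∈ xs ] g a x + P
    ≡⟨ cong (_+ P) (sym (∑-distrib-+ xs (g x) (λ b → g b x))) ⟩
  ∑[ b ∈ xs ] (g x b + g b x) + P
    ≡⟨ cong (_+ P) (sym (∑-map (x ,_) xs _)) ⟩
  ∑ (map (x ,_) xs) (λ (a , b) → g a b + g b a) + P
    ≡⟨ sym (∑-++ (map (x ,_) xs) (pairs xs) _) ⟩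
  ∑ (pairs (x ∷ xs)) (λ (a , b) → g a b + g b a) ∎
  where
  open ≡-Reasoning
  P : ℕ
  P = ∑ (pairs xs) (λ (a , b) → g a b + g b a)

∑³-triples : ∀ (xs : List A) (h : A → A → A → ℕ)
           → (∀ a b c → h a b c ≡ h b a c) → (∀ a b c → h a b c ≡ h a c b) → (∀ a c → h a a c ≡ 0)
           → ∑³ xs h ≡ 6 * ∑ (triples xs) (λ (a , b , c) → h a b c)
∑³-triples []       h sym₁₂ sym₂₃ diag = refl
∑³-triples (x ∷ xs) h sym₁₂ sym₂₃ diag = begin
  ∑[ b ∈ x ∷ xs ] ∑[ c ∈ x ∷ xs ] h x b c + ∑[ a ∈ xs ] ∑[ b ∈ x ∷ xs ] ∑[ c ∈ x ∷ xs ] h a b c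
    ≡⟨ cong₂ _+_ slice-x slices ⟩
  Q + (Q + (Q + ∑³ xs h))
    ≡⟨ cong₂ (λ u v → u + (u + (u + v))) Q≡2R (∑³-triples xs h sym₁₂ sym₂₃ diag) ⟩
  2 * R + (2 * R + (2 * R + 6 * Rest))
    ≡⟨ arith R Rest ⟩
  6 * (R + Rest)
    ≡⟨ cong (λ u → 6 * (u + Rest)) (sym (∑-map _ (pairs xs) _)) ⟩
  6 * (∑ (map _ (pairs xs)) (λ (a , b , c) → h a b c) + Rest)
    ≡⟨ cong (6 *_) (sym (∑-++ (map _ (pairs xs)) (triples xs) _)) ⟩
  6 * ∑ (triples (x ∷ xs)) (λ (a , b , c) → h a b c) ∎
  where
  open ≡-Reasoning
  Q R Rest : ℕ
  Q = ∑[ a ∈ xs ] ∑[ b ∈ xs ] h x a b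
  R = ∑ (pairs xs) (λ (a , b) → h x a b)
  Rest = ∑ (triples xs) (λ (a , b , c) → h a b c)

  arith : ∀ r t → 2 * r + (2 * r + (2 * r + 6 * t)) ≡ 6 * (r + t)
  arith = solve-∀

  Q≡2R : Q ≡ 2 * R
  Q≡2R = begin
    Q
      ≡⟨ ∑²-pairs xs (h x) (λ a → trans (sym₁₂ x a a) (trans (sym₂₃ a x a) (diag a x))) ⟩
    ∑ (pairs xs) (λ (a , b) → h x a b + h x b a)
      ≡⟨ ∑-cong (pairs xs) (λ (a , b) → cong (h x a b +_) (sym (sym₂₃ x a b))) ⟩
    ∑ (pairs xs) (λ (a , b) → h x a b + h x a b)
      ≡⟨ ∑-cong (pairs xs) (λ (a , b) → sym (double (h x a b))) ⟩
    ∑ (pairs xs) (λ (a , b) → 2 * h x a b)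
      ≡⟨ sym (*-distribˡ-∑ 2 (pairs xs) _) ⟩
    2 * R ∎
    where
    double : ∀ n → 2 * n ≡ n + n
    double = solve-∀

  slice-x : ∑[ b ∈ x ∷ xs ] ∑[ c ∈ x ∷ xs ] h x b c ≡ Q
  slice-x = cong₂ _+_ (cong₂ _+_ (diag x x) (trans (∑-cong xs (diag x)) (∑-zero xs)))
                      (∑-cong xs (λ b → cong (_+ ∑ xs (h x b)) (trans (sym₂₃ x b x) (diag x b))))

  slices : ∑[ a ∈ xs ] ∑[ b ∈ x ∷ xs ] ∑[ c ∈ x ∷ xs ] h a b c ≡ Q + (Q + ∑³ xs h)
  slices = begin
    ∑[ a ∈ xs ] (h a x x + ∑[ c ∈ xs ] h a x c + ∑[ b ∈ xs ] (h a b x + ∑[ c ∈ xs ] h a b c))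
      ≡⟨ ∑-cong xs slice ⟩
    ∑[ a ∈ xs ] (∑[ c ∈ xs ] h x a c + (∑[ b ∈ xs ] h x a b + ∑[ b ∈ xs ] ∑[ c ∈ xs ] h a b c))
      ≡⟨ ∑-distrib-+ xs _ _ ⟩
    Q + ∑[ a ∈ xs ] (∑[ b ∈ xs ] h x a b + ∑[ b ∈ xs ] ∑[ c ∈ xs ] h a b c)
      ≡⟨ cong (Q +_) (∑-distrib-+ xs _ _) ⟩
    Q + (Q + ∑³ xs h) ∎
    where
    slice : ∀ a → h a x x + ∑[ c ∈ xs ] h a x c + ∑[ b ∈ xs ] (h a b x + ∑[ c ∈ xs ] h a b c)
                ≡ ∑[ c ∈ xs ] h x a c + (∑[ b ∈ xs ] h x a b + ∑[ b ∈ xs ] ∑[ c ∈ xs ] h a b c)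
    slice a = cong₂ _+_
      (cong₂ _+_ (trans (sym₁₂ a x x) (trans (sym₂₃ x a x) (diag x a))) (∑-cong xs (sym₁₂ a x)))
      (trans (∑-distrib-+ xs _ _) (cong (_+ _) (∑-cong xs (λ b → trans (sym₂₃ a b x) (sym₁₂ a x b)))))

∑³-cong : ∀ (xs : List A) {h h′ : A → A → A → ℕ}
        → (∀ {a b c} → a ∈ xs → b ∈ xs → c ∈ xs → h a b c ≡ h′ a b c) → ∑³ xs h ≡ ∑³ xs h′
∑³-cong xs eq = ∑-cong-∈ xs λ a∈ → ∑-cong-∈ xs λ b∈ → ∑-cong-∈ xs λ c∈ → eq a∈ b∈ c∈

∑³-const : ∀ (xs : List A) n → ∑³ xs (λ _ _ _ → n) ≡ length xs * (length xs * (length xs * n))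
∑³-const xs n = trans (∑-cong xs (λ _ → trans (∑-cong xs (λ _ → ∑-const xs n)) (∑-const xs _))) (∑-const xs _)

∑³-distrib-+ : ∀ (xs : List A) (h h′ : A → A → A → ℕ)
             → ∑³ xs (λ a b c → h a b c + h′ a b c) ≡ ∑³ xs h + ∑³ xs h′
∑³-distrib-+ xs h h′ =
  trans (∑-cong xs λ _ → trans (∑-cong xs λ _ → ∑-distrib-+ xs _ _) (∑-distrib-+ xs _ _)) (∑-distrib-+ xs _ _)

*-distribˡ-∑³ : ∀ k (xs : List A) (h : A → A → A → ℕ) → k * ∑³ xs h ≡ ∑³ xs (λ a b c → k * h a b c)
*-distribˡ-∑³ k xs h =
  trans (*-distribˡ-∑ k xs _) (∑-cong xs λ _ → trans (*-distribˡ-∑ k xs _) (∑-cong xs λ _ → *-distribˡ-∑ k xs _))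

∑³-interchange : ∀ (xs : List A) (zs : List B) (H : A → B → A → B → A → B → ℕ)
  → ∑[ a₁ ∈ xs ] ∑[ c₁ ∈ zs ] ∑[ a₂ ∈ xs ] ∑[ c₂ ∈ zs ] ∑[ a₃ ∈ xs ] ∑[ c₃ ∈ zs ] H a₁ c₁ a₂ c₂ a₃ c₃
  ≡ ∑³ xs (λ a₁ a₂ a₃ → ∑³ zs (λ c₁ c₂ c₃ → H a₁ c₁ a₂ c₂ a₃ c₃))
∑³-interchange xs zs H = ∑-cong xs λ a₁ →
  trans (∑-comm zs xs _) (∑-cong xs λ a₂ →
    trans (∑-cong zs (λ c₁ → ∑-comm zs xs _)) (∑-comm zs xs _))

∑³-expand : ∀ (ys : List C) (xs : List A) (zs : List B) (φ : A → B → C) k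
  → (∀ F → k * ∑ ys F ≡ ∑[ a ∈ xs ] ∑[ c ∈ zs ] F (φ a c))
  → ∀ h → k * (k * (k * ∑³ ys h))
          ≡ ∑³ xs (λ a₁ a₂ a₃ → ∑³ zs (λ c₁ c₂ c₃ → h (φ a₁ c₁) (φ a₂ c₂) (φ a₃ c₃)))
∑³-expand ys xs zs φ k expand h = begin
  k * (k * (k * ∑³ ys h))
    ≡⟨ cong (k *_) (trans (cong (k *_) (*-distribˡ-∑ k ys _))
                          (trans (*-distribˡ-∑ k ys _) (∑-cong ys (λ _ → cong (k *_) (*-distribˡ-∑ k ys _))))) ⟩
  k * ∑ ys (λ b₁ → k * ∑ ys (λ b₂ → k * ∑ ys (h b₁ b₂)))
    ≡⟨ expand _ ⟩
  ∑[ a₁ ∈ xs ] ∑[ c₁ ∈ zs ] k * ∑ ys (λ b₂ → k * ∑ ys (h (φ a₁ c₁) b₂))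
    ≡⟨ ∑-cong xs (λ _ → ∑-cong zs (λ _ → expand _)) ⟩
  ∑[ a₁ ∈ xs ] ∑[ c₁ ∈ zs ] ∑[ a₂ ∈ xs ] ∑[ c₂ ∈ zs ] k * ∑ ys (h (φ a₁ c₁) (φ a₂ c₂))
    ≡⟨ ∑-cong xs (λ _ → ∑-cong zs (λ _ → ∑-cong xs (λ _ → ∑-cong zs (λ _ → expand _)))) ⟩
  ∑[ a₁ ∈ xs ] ∑[ c₁ ∈ zs ] ∑[ a₂ ∈ xs ] ∑[ c₂ ∈ zs ] ∑[ a₃ ∈ xs ] ∑[ c₃ ∈ zs ] h (φ a₁ c₁) (φ a₂ c₂) (φ a₃ c₃)
    ≡⟨ ∑³-interchange xs zs _ ⟩
  ∑³ xs (λ a₁ a₂ a₃ → ∑³ zs (λ c₁ c₂ c₃ → h (φ a₁ c₁) (φ a₂ c₂) (φ a₃ c₃))) ∎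
  where open ≡-Reasoning

∑³-expand₁ : ∀ (ys : List C) (xs : List A) (zs : List B) (φ : A → B → C)
  → (∀ F → ∑ ys F ≡ ∑[ a ∈ xs ] ∑[ c ∈ zs ] F (φ a c))
  → ∀ h → ∑³ ys h ≡ ∑³ xs (λ a₁ a₂ a₃ → ∑³ zs (λ c₁ c₂ c₃ → h (φ a₁ c₁) (φ a₂ c₂) (φ a₃ c₃)))
∑³-expand₁ ys xs zs φ expand h =
  trans (sym (trans (*-identityˡ _) (trans (*-identityˡ _) (*-identityˡ _))))
        (∑³-expand ys xs zs φ 1 (λ F → trans (*-identityˡ _) (expand F)) h)

-- Darts and edges

𝔹s : List Bool
𝔹s = false ∷ true ∷ []

∈-𝔹s : ∀ b → b ∈ 𝔹s
∈-𝔹s false = here refl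
∈-𝔹s true  = there (here refl)

orient : Bool → A × A → A × A
orient false e = e
orient true  e = swap e

lift : Bool → A × A → (A × Bool) × (A × Bool)
lift s (x , y) = (x , s) , (y , not s)

-- verts (γ G) and verts (L G) are definitionally darts and edges of adj G.
darts : (A → A → Bool) → List A → List (A × A)
darts r xs = filterᵇ (uncurry r) (cartesianProduct xs xs)

edges : (A → A → Bool) → List A → List (A × A)
edges r xs = filterᵇ (uncurry r) (pairs xs)

∈-darts⁻ : ∀ {r : A → A → Bool} {xs d} → d ∈ darts r xs → r (proj₁ d) (proj₂ d) ≡ true
∈-darts⁻ {r = r} {xs} d∈ = Equivalence.to T-≡ (proj₂ (∈-filter⁻ (T? ∘ uncurry r) {xs = cartesianProduct xs xs} d∈))

adj⇒≢ : ∀ {H : Graph} → (∀ a → adj H a a ≡ false) → ∀ {u w} → adj H u w ≡ true → u ≢ w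
adj⇒≢ adj-irrefl {u} u~w refl = contradiction (trans (sym (adj-irrefl u)) u~w) λ ()

module _ (r : A → A → Bool) (xs : List A) where

  ∑-darts : ∀ F → ∑ (darts r xs) F ≡ ∑[ a ∈ xs ] ∑[ b ∈ xs ] (if r a b then F (a , b) else 0)
  ∑-darts F = trans (∑-filterᵇ (uncurry r) (cartesianProduct xs xs) F) (∑-cartesianProduct xs xs _)

  ∑-darts-edges : (∀ a b → r a b ≡ r b a) → (∀ a → r a a ≡ false)
                → ∀ F → ∑ (darts r xs) F ≡ ∑[ e ∈ edges r xs ] ∑[ o ∈ 𝔹s ] F (orient o e)
  ∑-darts-edges r-sym r-irrefl F = begin
    ∑ (darts r xs) F
      ≡⟨ ∑-darts F ⟩
    ∑[ a ∈ xs ] ∑[ b ∈ xs ] (if r a b then F (a , b) else 0)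
      ≡⟨ ∑²-pairs xs _ (λ a → cong (if_then F (a , a) else 0) (r-irrefl a)) ⟩
    ∑ (pairs xs) (λ (a , b) → (if r a b then F (a , b) else 0) + (if r b a then F (b , a) else 0))
      ≡⟨ ∑-cong (pairs xs) (λ (a , b) → both-orientations a b) ⟩
    ∑ (pairs xs) (λ e → if uncurry r e then ∑[ o ∈ 𝔹s ] F (orient o e) else 0)
      ≡⟨ sym (∑-filterᵇ (uncurry r) (pairs xs) _) ⟩
    ∑[ e ∈ edges r xs ] ∑[ o ∈ 𝔹s ] F (orient o e) ∎
    where
    open ≡-Reasoning
    both-orientations : ∀ a b → (if r a b then F (a , b) else 0) + (if r b a then F (b , a) else 0)
                              ≡ (if r a b then F (a , b) + (F (b , a) + 0) else 0)
    both-orientations a b rewrite r-sym b a with r a b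
    ... | true  = cong (F (a , b) +_) (sym (+-identityʳ (F (b , a))))
    ... | false = refl

  ∑-darts-orient : (∀ a b → r a b ≡ r b a)
                 → ∀ F → 2 * ∑ (darts r xs) F ≡ ∑[ d ∈ darts r xs ] ∑[ o ∈ 𝔹s ] F (orient o d)
  ∑-darts-orient r-sym F = begin
    2 * ∑ (darts r xs) F
      ≡⟨ double (∑ (darts r xs) F) ⟩
    ∑ (darts r xs) F + ∑ (darts r xs) F
      ≡⟨ cong (∑ (darts r xs) F +_) darts-swap ⟩
    ∑ (darts r xs) F + ∑ (darts r xs) (F ∘ swap)
      ≡⟨ sym (∑-distrib-+ (darts r xs) F (F ∘ swap)) ⟩
    ∑[ d ∈ darts r xs ] (F d + F (swap d))
      ≡⟨ ∑-cong (darts r xs) (λ d → cong (F d +_) (sym (+-identityʳ (F (swap d))))) ⟩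
    ∑[ d ∈ darts r xs ] ∑[ o ∈ 𝔹s ] F (orient o d) ∎
    where
    open ≡-Reasoning
    double : ∀ n → 2 * n ≡ n + n
    double = solve-∀
    darts-swap : ∑ (darts r xs) F ≡ ∑ (darts r xs) (F ∘ swap)
    darts-swap = begin
      ∑ (darts r xs) F                                           ≡⟨ ∑-darts F ⟩
      ∑[ a ∈ xs ] ∑[ b ∈ xs ] (if r a b then F (a , b) else 0)  ≡⟨ ∑-comm xs xs _ ⟩
      ∑[ b ∈ xs ] ∑[ a ∈ xs ] (if r a b then F (a , b) else 0)  ≡⟨ ∑-cong xs (λ b → ∑-cong xs (λ a →
                                                                     cong (if_then F (a , b) else 0) (r-sym a b))) ⟩
      ∑[ b ∈ xs ] ∑[ a ∈ xs ] (if r b a then F (a , b) else 0)  ≡⟨ sym (∑-darts (F ∘ swap)) ⟩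
      ∑ (darts r xs) (F ∘ swap)                                  ∎

∑-darts-″ : ∀ (G : Graph) F
  → ∑ (darts (adj (G ″)) (verts (G ″))) F ≡ ∑[ d ∈ darts (adj G) (verts G) ] ∑[ s ∈ 𝔹s ] F (lift s d)
∑-darts-″ G F = begin
  ∑ (darts (adj (G ″)) (verts (G ″))) F
    ≡⟨ trans (∑-darts (adj (G ″)) (verts (G ″)) F) (∑-cartesianProduct xs 𝔹s _) ⟩
  ∑[ x ∈ xs ] ∑[ s ∈ 𝔹s ] ∑[ q ∈ verts (G ″) ] (if adj (G ″) (x , s) q then F ((x , s) , q) else 0)
    ≡⟨ ∑-cong xs (λ x → ∑-cong 𝔹s (λ s →
         trans (∑-cartesianProduct xs 𝔹s (λ q → if adj (G ″) (x , s) q then F ((x , s) , q) else 0))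
               (∑-cong xs (λ y → fibre (adj G x y) s (λ t → F ((x , s) , (y , t))))))) ⟩
  ∑[ x ∈ xs ] ∑[ s ∈ 𝔹s ] ∑[ y ∈ xs ] (if adj G x y then F (lift s (x , y)) else 0)
    ≡⟨ ∑-cong xs (λ x → ∑-comm 𝔹s xs (λ s y → if adj G x y then F (lift s (x , y)) else 0)) ⟩
  ∑[ x ∈ xs ] ∑[ y ∈ xs ] ∑[ s ∈ 𝔹s ] (if adj G x y then F (lift s (x , y)) else 0)
    ≡⟨ ∑-cong xs (λ x → ∑-cong xs (λ y → sym (if-∑ (adj G x y) 𝔹s (λ s → F (lift s (x , y)))))) ⟩
  ∑[ x ∈ xs ] ∑[ y ∈ xs ] (if adj G x y then ∑[ s ∈ 𝔹s ] F (lift s (x , y)) else 0)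
    ≡⟨ sym (∑-darts (adj G) xs (λ d → ∑[ s ∈ 𝔹s ] F (lift s d))) ⟩
  ∑[ d ∈ darts (adj G) xs ] ∑[ s ∈ 𝔹s ] F (lift s d) ∎
  where
  open ≡-Reasoning
  xs : List (V G)
  xs = verts G
  fibre : ∀ b s (f : Bool → ℕ) → ∑[ t ∈ 𝔹s ] (if b ∧ (s xor t) then f t else 0) ≡ (if b then f (not s) else 0)
  fibre true  false f = +-identityʳ (f true)
  fibre true  true  f = +-identityʳ (f false)
  fibre false s     f = refl

-- Triangles as sums over darts

triangleᵇ : (A → A → Bool) → A → A → A → Bool
triangleᵇ r a b c = r a b ∧ r a c ∧ r b c

module _ (r : A → A → Bool) (r-sym : ∀ a b → r a b ≡ r b a) where

  triangleᵇ-swap₁₂ : ∀ a b c → triangleᵇ r a b c ≡ triangleᵇ r b a c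
  triangleᵇ-swap₁₂ a b c rewrite r-sym b a = cong (r a b ∧_) (∧-comm (r a c) (r b c))

  triangleᵇ-swap₂₃ : ∀ a b c → triangleᵇ r a b c ≡ triangleᵇ r a c b
  triangleᵇ-swap₂₃ a b c rewrite r-sym c b = ∧-left-comm (r a b) (r a c) (r b c)

triangleᵇ-cong : ∀ {r r′ : A → A → Bool} → (∀ x y → r x y ≡ r′ x y) → ∀ a b c → triangleᵇ r a b c ≡ triangleᵇ r′ a b c
triangleᵇ-cong r≗r′ a b c rewrite r≗r′ a b | r≗r′ a c | r≗r′ b c = refl

⌊_⌋₂ : DecidableEquality A → A → A → Bool
⌊ _≟_ ⌋₂ x y = ⌊ x ≟ y ⌋

-- adj (L G) and adj (γ G) are definitionally lineAdj and dartAdj of ⌊ _≟V_ G ⌋₂.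
lineAdj : (A → A → Bool) → A × A → A × A → Bool
lineAdj _≐_ (a , b) (c , d) = not ((a ≐ c ∧ b ≐ d) ∨ (a ≐ d ∧ b ≐ c)) ∧ (a ≐ c ∨ a ≐ d ∨ b ≐ c ∨ b ≐ d)

dartAdj : (A → A → Bool) → A × A → A × A → Bool
dartAdj _≐_ (u , v) (x , y) = (v ≐ x ∧ not (y ≐ u)) ∨ (y ≐ u ∧ not (x ≐ v))

module _ (_≐_ : A → A → Bool) where

  lineAdj-swapˡ : ∀ e f → lineAdj _≐_ (swap e) f ≡ lineAdj _≐_ e f
  lineAdj-swapˡ (a , b) (c , d) = cong₂ (λ p q → not p ∧ q)
    (trans (∨-comm (b ≐ c ∧ a ≐ d) (b ≐ d ∧ a ≐ c)) (cong₂ _∨_ (∧-comm (b ≐ d) (a ≐ c)) (∧-comm (b ≐ c) (a ≐ d))))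
    (trans (sym (∨-assoc (b ≐ c) (b ≐ d) (a ≐ c ∨ a ≐ d)))
           (trans (∨-comm (b ≐ c ∨ b ≐ d) (a ≐ c ∨ a ≐ d)) (∨-assoc (a ≐ c) (a ≐ d) (b ≐ c ∨ b ≐ d))))

  lineAdj-swapʳ : ∀ e f → lineAdj _≐_ e (swap f) ≡ lineAdj _≐_ e f
  lineAdj-swapʳ (a , b) (c , d) = cong₂ (λ p q → not p ∧ q)
    (∨-comm (a ≐ d ∧ b ≐ c) (a ≐ c ∧ b ≐ d))
    (trans (∨-left-comm (a ≐ d) (a ≐ c) (b ≐ d ∨ b ≐ c)) (cong (λ q → a ≐ c ∨ a ≐ d ∨ q) (∨-comm (b ≐ d) (b ≐ c))))

  lineAdj-orient : ∀ o o′ e f → lineAdj _≐_ (orient o e) (orient o′ f) ≡ lineAdj _≐_ e f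
  lineAdj-orient false false e f = refl
  lineAdj-orient false true  e f = lineAdj-swapʳ e f
  lineAdj-orient true  false e f = lineAdj-swapˡ e f
  lineAdj-orient true  true  e f = trans (lineAdj-swapˡ e (swap f)) (lineAdj-swapʳ e f)

  triangleᵇ-lineAdj-orient : ∀ o₁ o₂ o₃ e₁ e₂ e₃
    → triangleᵇ (lineAdj _≐_) (orient o₁ e₁) (orient o₂ e₂) (orient o₃ e₃) ≡ triangleᵇ (lineAdj _≐_) e₁ e₂ e₃
  triangleᵇ-lineAdj-orient o₁ o₂ o₃ e₁ e₂ e₃
    rewrite lineAdj-orient o₁ o₂ e₁ e₂ | lineAdj-orient o₁ o₃ e₁ e₃ | lineAdj-orient o₂ o₃ e₂ e₃ = refl

  lineAdj-irrefl : (∀ x → x ≐ x ≡ true) → ∀ e → lineAdj _≐_ e e ≡ false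
  lineAdj-irrefl ≐-refl (a , b) rewrite ≐-refl a | ≐-refl b = refl

  module _ (≐-sym : ∀ x y → x ≐ y ≡ y ≐ x) where

    lineAdj-sym : ∀ e f → lineAdj _≐_ e f ≡ lineAdj _≐_ f e
    lineAdj-sym (a , b) (c , d) rewrite ≐-sym c a | ≐-sym d b | ≐-sym c b | ≐-sym d a = cong₂ (λ p q → not p ∧ q)
      (cong ((a ≐ c ∧ b ≐ d) ∨_) (∧-comm (a ≐ d) (b ≐ c)))
      (cong (a ≐ c ∨_) (∨-left-comm (a ≐ d) (b ≐ c) (b ≐ d)))

    dartAdj-sym : ∀ e f → dartAdj _≐_ e f ≡ dartAdj _≐_ f e
    dartAdj-sym (u , v) (x , y) rewrite ≐-sym u y | ≐-sym x v = ∨-comm (v ≐ x ∧ not (y ≐ u)) (y ≐ u ∧ not (v ≐ x))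

    dartAdj-irrefl : ∀ e → dartAdj _≐_ e e ≡ false
    dartAdj-irrefl (u , v) rewrite ≐-sym u v = cong₂ _∨_ (∧-inverseʳ (v ≐ u)) (∧-inverseʳ (v ≐ u))

module _ {_≐_ _≐′_ : A → A → Bool} (≐≗≐′ : ∀ x y → x ≐ y ≡ x ≐′ y) where

  lineAdj-cong : ∀ e f → lineAdj _≐_ e f ≡ lineAdj _≐′_ e f
  lineAdj-cong (a , b) (c , d) rewrite ≐≗≐′ a c | ≐≗≐′ b d | ≐≗≐′ a d | ≐≗≐′ b c = refl

  dartAdj-cong : ∀ e f → dartAdj _≐_ e f ≡ dartAdj _≐′_ e f
  dartAdj-cong (u , v) (x , y) rewrite ≐≗≐′ v x | ≐≗≐′ y u | ≐≗≐′ x v = refl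

module _ (_≟_ : DecidableEquality A) where

  ⌊≟⌋-refl : ∀ x → ⌊ x ≟ x ⌋ ≡ true
  ⌊≟⌋-refl x = trans (isYes≗does (x ≟ x)) (dec-true (x ≟ x) refl)

  ⌊≟⌋-sym : ∀ x y → ⌊ x ≟ y ⌋ ≡ ⌊ y ≟ x ⌋
  ⌊≟⌋-sym x y = trans (isYes≗does (x ≟ y))
                      (trans (does-⇔ (mk⇔ sym sym) (x ≟ y) (y ≟ x)) (sym (isYes≗does (y ≟ x))))

triangles-∑³ : ∀ (G : Graph) → (∀ a b → adj G a b ≡ adj G b a) → (∀ a → adj G a a ≡ false)
             → 6 * triangles G ≡ ∑³ (verts G) (λ a b c → 𝟙 (triangleᵇ (adj G) a b c))
triangles-∑³ G adj-sym adj-irrefl = trans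
  (cong (6 *_) (length-filterᵇ _ (triples (verts G))))
  (sym (∑³-triples (verts G) _ (λ a b c → cong 𝟙 (triangleᵇ-swap₁₂ (adj G) adj-sym a b c))
                               (λ a b c → cong 𝟙 (triangleᵇ-swap₂₃ (adj G) adj-sym a b c))
                               (λ a c → cong (λ u → 𝟙 (u ∧ adj G a c ∧ adj G a c)) (adj-irrefl a))))

module _ (G : Graph) where

  L-adj-sym : ∀ e f → adj (L G) e f ≡ adj (L G) f e
  L-adj-sym = lineAdj-sym ⌊ _≟V_ G ⌋₂ (⌊≟⌋-sym (_≟V_ G))

  L-adj-irrefl : ∀ e → adj (L G) e e ≡ false
  L-adj-irrefl = lineAdj-irrefl ⌊ _≟V_ G ⌋₂ (⌊≟⌋-refl (_≟V_ G))

  γ-adj-sym : ∀ e f → adj (γ G) e f ≡ adj (γ G) f e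
  γ-adj-sym = dartAdj-sym ⌊ _≟V_ G ⌋₂ (⌊≟⌋-sym (_≟V_ G))

  γ-adj-irrefl : ∀ e → adj (γ G) e e ≡ false
  γ-adj-irrefl = dartAdj-irrefl ⌊ _≟V_ G ⌋₂ (⌊≟⌋-sym (_≟V_ G))

  module _ (adj-sym : ∀ a b → adj G a b ≡ adj G b a) (adj-irrefl : ∀ a → adj G a a ≡ false) where

    triangles-γ : 6 * triangles (γ G)
                ≡ ∑³ (darts (adj G) (verts G)) (λ d₁ d₂ d₃ → 𝟙 (triangleᵇ (adj (γ G)) d₁ d₂ d₃))
    triangles-γ = triangles-∑³ (γ G) γ-adj-sym γ-adj-irrefl

    -- 48 = 3! orderings times 2³ orientations of three edges.
    triangles-L : 48 * triangles (L G)
                ≡ ∑³ (darts (adj G) (verts G)) (λ d₁ d₂ d₃ → 𝟙 (triangleᵇ (adj (L G)) d₁ d₂ d₃))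
    triangles-L = begin
      48 * triangles (L G)
        ≡⟨ *-assoc 8 6 (triangles (L G)) ⟩
      8 * (6 * triangles (L G))
        ≡⟨ cong (8 *_) (triangles-∑³ (L G) L-adj-sym L-adj-irrefl) ⟩
      8 * ∑³ E △
        ≡⟨ *-distribˡ-∑³ 8 E △ ⟩
      ∑³ E (λ e₁ e₂ e₃ → 8 * △ e₁ e₂ e₃)
        ≡⟨ ∑³-cong E (λ {e₁} {e₂} {e₃} _ _ _ → eight-orientations e₁ e₂ e₃) ⟩
      ∑³ E (λ e₁ e₂ e₃ → ∑³ 𝔹s (λ o₁ o₂ o₃ → △ (orient o₁ e₁) (orient o₂ e₂) (orient o₃ e₃)))
        ≡⟨ sym (∑³-expand₁ D E 𝔹s (λ e o → orient o e) (∑-darts-edges (adj G) (verts G) adj-sym adj-irrefl) △) ⟩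
      ∑³ D △ ∎
      where
      open ≡-Reasoning
      E D : List (V G × V G)
      E = verts (L G)
      D = darts (adj G) (verts G)
      △ : V G × V G → V G × V G → V G × V G → ℕ
      △ d₁ d₂ d₃ = 𝟙 (triangleᵇ (adj (L G)) d₁ d₂ d₃)
      eight-orientations : ∀ e₁ e₂ e₃
                         → 8 * △ e₁ e₂ e₃ ≡ ∑³ 𝔹s (λ o₁ o₂ o₃ → △ (orient o₁ e₁) (orient o₂ e₂) (orient o₃ e₃))
      eight-orientations e₁ e₂ e₃ = begin
        8 * △ e₁ e₂ e₃                  ≡⟨ eight (△ e₁ e₂ e₃) ⟩
        2 * (2 * (2 * △ e₁ e₂ e₃))      ≡⟨ sym (∑³-const 𝔹s (△ e₁ e₂ e₃)) ⟩
        ∑³ 𝔹s (λ _ _ _ → △ e₁ e₂ e₃)    ≡⟨ ∑³-cong 𝔹s (λ {o₁} {o₂} {o₃} _ _ _ →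
                                             cong 𝟙 (sym (triangleᵇ-lineAdj-orient ⌊ _≟V_ G ⌋₂ o₁ o₂ o₃ e₁ e₂ e₃))) ⟩
        ∑³ 𝔹s (λ o₁ o₂ o₃ → △ (orient o₁ e₁) (orient o₂ e₂) (orient o₃ e₃)) ∎
        where
        eight : ∀ n → 8 * n ≡ 2 * (2 * (2 * n))
        eight = solve-∀

-- The six-point identity

coverEq : (A → A → Bool) → A × Bool → A × Bool → Bool
coverEq _≐_ (x , s) (y , t) = x ≐ y ∧ ⌊ s ≟𝔹 t ⌋

LocalIdentity : (A → A → Bool) → A × A → A × A → A × A → Set
LocalIdentity _≐_ e₁ e₂ e₃ =
  2 * 𝟙 (triangleᵇ (lineAdj _≐_) e₁ e₂ e₃)
    ≡ ∑³ 𝔹s (λ o₁ o₂ o₃ → 𝟙 (triangleᵇ (dartAdj _≐_) (orient o₁ e₁) (orient o₂ e₂) (orient o₃ e₃)))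
    + ∑³ 𝔹s (λ s₁ s₂ s₃ → 𝟙 (triangleᵇ (lineAdj (coverEq _≐_)) (lift s₁ e₁) (lift s₂ e₂) (lift s₃ e₃)))

LocalIdentity-cong : ∀ {_≐_ _≐′_ : A → A → Bool} → (∀ x y → x ≐ y ≡ x ≐′ y)
                   → ∀ e₁ e₂ e₃ → LocalIdentity _≐_ e₁ e₂ e₃ → LocalIdentity _≐′_ e₁ e₂ e₃
LocalIdentity-cong {_≐_ = _≐_} {_≐′_} ≐≗≐′ e₁ e₂ e₃ = subst₂ _≡_
  (cong (λ b → 2 * 𝟙 b) (triangleᵇ-cong (lineAdj-cong ≐≗≐′) e₁ e₂ e₃))
  (cong₂ _+_
    (∑³-cong 𝔹s λ {o₁} {o₂} {o₃} _ _ _ →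
      cong 𝟙 (triangleᵇ-cong (dartAdj-cong ≐≗≐′) (orient o₁ e₁) (orient o₂ e₂) (orient o₃ e₃)))
    (∑³-cong 𝔹s λ {s₁} {s₂} {s₃} _ _ _ →
      cong 𝟙 (triangleᵇ-cong (lineAdj-cong coverEq-cong) (lift s₁ e₁) (lift s₂ e₂) (lift s₃ e₃))))
  where
  coverEq-cong : ∀ p q → coverEq _≐_ p q ≡ coverEq _≐′_ p q
  coverEq-cong (x , s) (y , t) = cong (_∧ ⌊ s ≟𝔹 t ⌋) (≐≗≐′ x y)

-- The bound cᵢ ≤ i says that cᵢ is the position of the first occurrence of its value, so every
-- equality pattern of six points occurs; the 6! such tuples are checked by evaluation.
CanonicalLocalIdentities : Set
CanonicalLocalIdentities =
  ∀ (c₀ : Fin 6) → toℕ c₀ ≤ 0 → ∀ c₁ → toℕ c₁ ≤ 1 → ∀ c₂ → toℕ c₂ ≤ 2 →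
  ∀ c₃ → toℕ c₃ ≤ 3 → ∀ c₄ → toℕ c₄ ≤ 4 → ∀ c₅ → toℕ c₅ ≤ 5 →
  c₀ ≢ c₁ → c₂ ≢ c₃ → c₄ ≢ c₅ → LocalIdentity ⌊ _≟ᶠ_ ⌋₂ (c₀ , c₁) (c₂ , c₃) (c₄ , c₅)

canonicalLocalIdentities : CanonicalLocalIdentities
canonicalLocalIdentities = from-yes decision
  where
  decision : Dec CanonicalLocalIdentities
  decision =
    all? λ c₀ → toℕ c₀ ≤? 0 →-dec all? λ c₁ → toℕ c₁ ≤? 1 →-dec all? λ c₂ → toℕ c₂ ≤? 2 →-dec
    all? λ c₃ → toℕ c₃ ≤? 3 →-dec all? λ c₄ → toℕ c₄ ≤? 4 →-dec all? λ c₅ → toℕ c₅ ≤? 5 →-dec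
    ¬? (c₀ ≟ᶠ c₁) →-dec ¬? (c₂ ≟ᶠ c₃) →-dec ¬? (c₄ ≟ᶠ c₅) →-dec _ ≟ _

module _ (_≟_ : DecidableEquality A) where

  firstIndex : ∀ {k} → (Fin (suc k) → A) → A → Fin (suc k)
  firstIndex {zero}  v x = zero
  firstIndex {suc k} v x with v zero ≟ x
  ... | yes _ = zero
  ... | no  _ = suc (firstIndex (v ∘ suc) x)

  firstIndex-sound : ∀ {k} (v : Fin (suc k) → A) i → v (firstIndex v (v i)) ≡ v i
  firstIndex-sound {zero}  v zero = refl
  firstIndex-sound {suc k} v zero with v zero ≟ v zero
  ... | yes p  = p
  ... | no  ¬p = contradiction refl ¬p
  firstIndex-sound {suc k} v (suc i) with v zero ≟ v (suc i)
  ... | yes p = p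
  ... | no  _ = firstIndex-sound (v ∘ suc) i

  firstIndex-≤ : ∀ {k} (v : Fin (suc k) → A) i → toℕ (firstIndex v (v i)) ≤ toℕ i
  firstIndex-≤ {zero}  v zero = z≤n
  firstIndex-≤ {suc k} v zero with v zero ≟ v zero
  ... | yes _  = z≤n
  ... | no  ¬p = contradiction refl ¬p
  firstIndex-≤ {suc k} v (suc i) with v zero ≟ v (suc i)
  ... | yes _ = z≤n
  ... | no  _ = s≤s (firstIndex-≤ (v ∘ suc) i)

  localIdentity : ∀ x₀ x₁ x₂ x₃ x₄ x₅ → x₀ ≢ x₁ → x₂ ≢ x₃ → x₄ ≢ x₅
                → LocalIdentity ⌊ _≟_ ⌋₂ (x₀ , x₁) (x₂ , x₃) (x₄ , x₅)
  localIdentity x₀ x₁ x₂ x₃ x₄ x₅ x₀≢x₁ x₂≢x₃ x₄≢x₅ =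
    LocalIdentity-cong same-pattern (# 0 , # 1) (# 2 , # 3) (# 4 , # 5)
      (canonicalLocalIdentities (c (# 0)) (firstIndex-≤ v (# 0)) (c (# 1)) (firstIndex-≤ v (# 1))
                                (c (# 2)) (firstIndex-≤ v (# 2)) (c (# 3)) (firstIndex-≤ v (# 3))
                                (c (# 4)) (firstIndex-≤ v (# 4)) (c (# 5)) (firstIndex-≤ v (# 5))
                                (c-respects-≢ (# 0) (# 1) x₀≢x₁) (c-respects-≢ (# 2) (# 3) x₂≢x₃)
                                (c-respects-≢ (# 4) (# 5) x₄≢x₅))
    where
    v : Fin 6 → A
    v = Vec.lookup (x₀ ∷ x₁ ∷ x₂ ∷ x₃ ∷ x₄ ∷ x₅ ∷ [])
    c : Fin 6 → Fin 6
    c i = firstIndex v (v i)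
    c≡⇔v≡ : ∀ i j → c i ≡ c j ⇔ v i ≡ v j
    c≡⇔v≡ i j = mk⇔ (λ eq → trans (sym (firstIndex-sound v i)) (trans (cong v eq) (firstIndex-sound v j)))
                         (cong (firstIndex v))
    c-respects-≢ : ∀ i j → v i ≢ v j → c i ≢ c j
    c-respects-≢ i j v≢ = v≢ ∘ Equivalence.to (c≡⇔v≡ i j)
    same-pattern : ∀ i j → ⌊ c i ≟ᶠ c j ⌋ ≡ ⌊ v i ≟ v j ⌋
    same-pattern i j = trans (isYes≗does (c i ≟ᶠ c j))
                             (trans (does-⇔ (c≡⇔v≡ i j) (c i ≟ᶠ c j) (v i ≟ v j)) (sym (isYes≗does (v i ≟ v j))))

coverEq-⌊≡-dec⌋ : ∀ (_≟_ : DecidableEquality A) p q → coverEq ⌊ _≟_ ⌋₂ p q ≡ ⌊ ≡-dec _≟_ _≟𝔹_ ⌋₂ p q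
coverEq-⌊≡-dec⌋ _≟_ (x , s) (y , t) = begin
  ⌊ x ≟ y ⌋ ∧ ⌊ s ≟𝔹 t ⌋                 ≡⟨ cong₂ _∧_ (isYes≗does (x ≟ y)) (isYes≗does (s ≟𝔹 t)) ⟩
  does (x ≟ y ×-dec s ≟𝔹 t)               ≡⟨ does-⇔ (mk⇔ (λ (p , q) → cong₂ _,_ p q) ,-injective)
                                                      (x ≟ y ×-dec s ≟𝔹 t) (≡-dec _≟_ _≟𝔹_ (x , s) (y , t)) ⟩
  does (≡-dec _≟_ _≟𝔹_ (x , s) (y , t))   ≡⟨ sym (isYes≗does _) ⟩
  ⌊ ≡-dec _≟_ _≟𝔹_ (x , s) (y , t) ⌋     ∎
  where open ≡-Reasoning

-- The double cover X″

parity : ∀ {H : Graph} {u v} → Reachable H u v → Bool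
parity here         = false
parity (step _ _ r) = not (parity r)

not-xor-swap : ∀ a b → not a xor b ≡ a xor not b
not-xor-swap a b = trans (sym (not-distribˡ-xor a b)) (not-distribʳ-xor a b)

module _ (G : Graph) where

  ″-adj-irrefl : ∀ p → adj (G ″) p p ≡ false
  ″-adj-irrefl (x , s) = trans (cong (adj G x x ∧_) (xor-same s)) (∧-zeroʳ (adj G x x))

  ″-adj-sym : (∀ a b → adj G a b ≡ adj G b a) → ∀ p q → adj (G ″) p q ≡ adj (G ″) q p
  ″-adj-sym adj-sym (x , s) (y , t) = cong₂ _∧_ (adj-sym x y) (xor-comm s t)

  ″-unique : Unique (verts G) → Unique (verts (G ″))
  ″-unique unique = cartesianProduct⁺ unique (((λ ()) ∷ []) ∷ [] ∷ [])

  ″-step : ∀ {x y} → adj G x y ≡ true → ∀ s → adj (G ″) (x , s) (y , not s) ≡ true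
  ″-step x~y s = cong₂ _∧_ x~y (trans (sym (not-distribʳ-xor s s)) (cong not (xor-same s)))

  lift-walk : ∀ {x y} (w : Reachable G x y) s → Reachable (G ″) (x , s) (y , s xor parity w)
  lift-walk here s = subst (λ t → Reachable (G ″) (_ , s) (_ , t)) (sym (xor-identityʳ s)) here
  lift-walk (step {w = w} x~w w∈ r) s =
    step (″-step x~w s) (∈-cartesianProduct⁺ w∈ (∈-𝔹s (not s)))
         (subst (λ t → Reachable (G ″) (w , not s) (_ , t)) (not-xor-swap s (parity r)) (lift-walk r (not s)))

module _ (G : Graph) (adj-sym : ∀ a b → adj G a b ≡ adj G b a) (adj-irrefl : ∀ a → adj G a a ≡ false) where

  private
    D : List (V G × V G)
    D = darts (adj G) (verts G)

    dart-proper : ∀ {d} → d ∈ D → proj₁ d ≢ proj₂ d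
    dart-proper d∈ = adj⇒≢ {G} adj-irrefl (∈-darts⁻ {r = adj G} {xs = verts G} d∈)

    △L △γ : V G × V G → V G × V G → V G × V G → ℕ
    △L d₁ d₂ d₃ = 𝟙 (triangleᵇ (adj (L G)) d₁ d₂ d₃)
    △γ d₁ d₂ d₃ = 𝟙 (triangleᵇ (adj (γ G)) d₁ d₂ d₃)

    △L″ : (V G × Bool) × (V G × Bool) → (V G × Bool) × (V G × Bool) → (V G × Bool) × (V G × Bool) → ℕ
    △L″ d₁ d₂ d₃ = 𝟙 (triangleᵇ (adj (L (G ″))) d₁ d₂ d₃)

    local-identity : ∀ {d₁ d₂ d₃} → d₁ ∈ D → d₂ ∈ D → d₃ ∈ D
          → 2 * △L d₁ d₂ d₃ ≡ ∑³ 𝔹s (λ o₁ o₂ o₃ → △γ (orient o₁ d₁) (orient o₂ d₂) (orient o₃ d₃))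
                            + ∑³ 𝔹s (λ s₁ s₂ s₃ → △L″ (lift s₁ d₁) (lift s₂ d₂) (lift s₃ d₃))
    local-identity {x₀ , x₁} {x₂ , x₃} {x₄ , x₅} d₁∈ d₂∈ d₃∈ =
      trans (localIdentity (_≟V_ G) x₀ x₁ x₂ x₃ x₄ x₅ (dart-proper d₁∈) (dart-proper d₂∈) (dart-proper d₃∈))
            (cong (∑³ 𝔹s (λ o₁ o₂ o₃ → △γ (orient o₁ (x₀ , x₁)) (orient o₂ (x₂ , x₃)) (orient o₃ (x₄ , x₅))) +_)
                  (∑³-cong 𝔹s λ {s₁} {s₂} {s₃} _ _ _ → cong 𝟙
              (triangleᵇ-cong (lineAdj-cong (coverEq-⌊≡-dec⌋ (_≟V_ G)))
                              (lift s₁ (x₀ , x₁)) (lift s₂ (x₂ , x₃)) (lift s₃ (x₄ , x₅)))))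

  2*triangles-L≡triangles-γ+triangles-L″ : 2 * triangles (L G) ≡ triangles (γ G) + triangles (L (G ″))
  2*triangles-L≡triangles-γ+triangles-L″ = *-cancelˡ-≡ _ _ 48 (begin
    48 * (2 * triangles (L G))
      ≡⟨ *-comm-48-2 (triangles (L G)) ⟩
    2 * (48 * triangles (L G))
      ≡⟨ cong (2 *_) (triangles-L G adj-sym adj-irrefl) ⟩
    2 * ∑³ D △L
      ≡⟨ *-distribˡ-∑³ 2 D △L ⟩
    ∑³ D (λ d₁ d₂ d₃ → 2 * △L d₁ d₂ d₃)
      ≡⟨ ∑³-cong D local-identity ⟩
    ∑³ D (λ d₁ d₂ d₃ → ∑³ 𝔹s (λ o₁ o₂ o₃ → △γ (orient o₁ d₁) (orient o₂ d₂) (orient o₃ d₃))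
                    + ∑³ 𝔹s (λ s₁ s₂ s₃ → △L″ (lift s₁ d₁) (lift s₂ d₂) (lift s₃ d₃)))
      ≡⟨ ∑³-distrib-+ D _ _ ⟩
    ∑³ D (λ d₁ d₂ d₃ → ∑³ 𝔹s (λ o₁ o₂ o₃ → △γ (orient o₁ d₁) (orient o₂ d₂) (orient o₃ d₃)))
    + ∑³ D (λ d₁ d₂ d₃ → ∑³ 𝔹s (λ s₁ s₂ s₃ → △L″ (lift s₁ d₁) (lift s₂ d₂) (lift s₃ d₃)))
      ≡⟨ sym (cong₂ _+_ (∑³-expand D D 𝔹s (λ d o → orient o d) 2 (∑-darts-orient (adj G) (verts G) adj-sym) △γ)
                        (∑³-expand₁ (darts (adj (G ″)) (verts (G ″))) D 𝔹s (λ d s → lift s d) (∑-darts-″ G) △L″)) ⟩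
    2 * (2 * (2 * ∑³ D △γ)) + ∑³ (darts (adj (G ″)) (verts (G ″))) △L″
      ≡⟨ cong₂ (λ u v → 2 * (2 * (2 * u)) + v)
               (sym (triangles-γ G adj-sym adj-irrefl))
               (sym (triangles-L (G ″) (″-adj-sym G adj-sym) (″-adj-irrefl G))) ⟩
    2 * (2 * (2 * (6 * triangles (γ G)))) + 48 * triangles (L (G ″))
      ≡⟨ arith (triangles (γ G)) (triangles (L (G ″))) ⟩
    48 * (triangles (γ G) + triangles (L (G ″))) ∎)
    where
    open ≡-Reasoning
    *-comm-48-2 : ∀ n → 48 * (2 * n) ≡ 2 * (48 * n)
    *-comm-48-2 = solve-∀
    arith : ∀ g p → 2 * (2 * (2 * (6 * g))) + 48 * p ≡ 48 * (g + p)
    arith = solve-∀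

-- Connectivity of line graphs

∈-pairs⁻ : ∀ {xs : List A} {x y} → (x , y) ∈ pairs xs → x ∈ xs × y ∈ xs
∈-pairs⁻ {xs = z ∷ zs} m with ∈-++⁻ (map (z ,_) zs) m
... | inj₂ m′ = Product.map there there (∈-pairs⁻ m′)
... | inj₁ m′ with ∈-map⁻ (z ,_) m′
... | _ , y∈zs , refl = here refl , there y∈zs

∈-pairs⁺ : ∀ {xs : List A} {x y} → x ∈ xs → y ∈ xs → x ≢ y → (x , y) ∈ pairs xs ⊎ (y , x) ∈ pairs xs
∈-pairs⁺ {xs = z ∷ zs} (here refl) (here refl) x≢y = contradiction refl x≢y
∈-pairs⁺ {xs = z ∷ zs} (here refl) (there y∈) _   = inj₁ (∈-++⁺ˡ (∈-map⁺ (z ,_) y∈))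
∈-pairs⁺ {xs = z ∷ zs} (there x∈) (here refl) _   = inj₂ (∈-++⁺ˡ (∈-map⁺ (z ,_) x∈))
∈-pairs⁺ {xs = z ∷ zs} (there x∈) (there y∈) x≢y =
  Sum.map (∈-++⁺ʳ (map (z ,_) zs)) (∈-++⁺ʳ (map (z ,_) zs)) (∈-pairs⁺ x∈ y∈ x≢y)

pairs-head-not-second : ∀ {z} {zs : List A} {y} → All (z ≢_) zs → (y , z) ∉ pairs (z ∷ zs)
pairs-head-not-second {z = z} {zs} z∉zs m with ∈-++⁻ (map (z ,_) zs) m
... | inj₂ n = All.lookup z∉zs (proj₂ (∈-pairs⁻ n)) refl
... | inj₁ n with ∈-map⁻ (z ,_) n
...   | _ , z∈zs , refl = All.lookup z∉zs z∈zs refl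

pairs-asym : ∀ {xs : List A} {x y} → Unique xs → (x , y) ∈ pairs xs → (y , x) ∉ pairs xs
pairs-asym {xs = z ∷ zs} (z∉zs ∷ unique) m m′ with ∈-++⁻ (map (z ,_) zs) m
... | inj₁ n with ∈-map⁻ (z ,_) n
...   | _ , _ , refl = pairs-head-not-second z∉zs m′
pairs-asym {xs = z ∷ zs} (z∉zs ∷ unique) m m′ | inj₂ n with ∈-++⁻ (map (z ,_) zs) m′
...   | inj₂ n′ = pairs-asym unique n n′
...   | inj₁ n′ with ∈-map⁻ (z ,_) n′
...     | _ , _ , refl = All.lookup z∉zs (proj₂ (∈-pairs⁻ n)) refl

Meet : A × A → A × A → Set
Meet (a , b) (c , d) = a ≡ c ⊎ a ≡ d ⊎ b ≡ c ⊎ b ≡ d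

LineAdjacent : A × A → A × A → Set
LineAdjacent (a , b) (c , d) = ¬ ((a ≡ c × b ≡ d) ⊎ (a ≡ d × b ≡ c)) × Meet (a , b) (c , d)

module _ (_≟_ : DecidableEquality A) where

  lineAdjacent? : ∀ e f → Dec (LineAdjacent e f)
  lineAdjacent? (a , b) (c , d) =
    ¬? ((a ≟ c ×-dec b ≟ d) ⊎-dec (a ≟ d ×-dec b ≟ c)) ×-dec (a ≟ c ⊎-dec a ≟ d ⊎-dec b ≟ c ⊎-dec b ≟ d)

  lineAdj-reflects : ∀ e f → lineAdj ⌊ _≟_ ⌋₂ e f ≡ ⌊ lineAdjacent? e f ⌋
  lineAdj-reflects e f = trans (lineAdj-cong (λ x y → isYes≗does (x ≟ y)) e f) (sym (isYes≗does (lineAdjacent? e f)))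

  lineAdj⇒Meet : ∀ e f → lineAdj ⌊ _≟_ ⌋₂ e f ≡ true → Meet e f
  lineAdj⇒Meet e f e~f = proj₂ (toWitness (Equivalence.from T-≡ (trans (sym (lineAdj-reflects e f)) e~f)))

  Meet⇒lineAdj : ∀ e f → e ≢ f → swap e ≢ f → Meet e f → lineAdj ⌊ _≟_ ⌋₂ e f ≡ true
  Meet⇒lineAdj e f e≢f swap-e≢f meet =
    trans (lineAdj-reflects e f) (Equivalence.to T-≡ (fromWitness (distinct , meet)))
    where
    distinct : ¬ ((proj₁ e ≡ proj₁ f × proj₂ e ≡ proj₂ f) ⊎ (proj₁ e ≡ proj₂ f × proj₂ e ≡ proj₁ f))
    distinct (inj₁ (p , q)) = e≢f (cong₂ _,_ p q)
    distinct (inj₂ (p , q)) = swap-e≢f (cong₂ _,_ q p)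

Reachable-trans : ∀ {H : Graph} {u v w} → Reachable H u v → Reachable H v w → Reachable H u w
Reachable-trans here             r′ = r′
Reachable-trans (step u~w w∈ r) r′ = step u~w w∈ (Reachable-trans r r′)

Reachable-sym : ∀ {H : Graph} → (∀ a b → adj H a b ≡ adj H b a)
              → ∀ {u v} → u ∈ verts H → Reachable H u v → Reachable H v u
Reachable-sym adj-sym u∈ here = here
Reachable-sym adj-sym {u} u∈ (step {w = w} u~w w∈ r) =
  Reachable-trans (Reachable-sym adj-sym w∈ r) (step (trans (adj-sym w u) u~w) u∈ here)

module _ (H : Graph) where

  Incident : V H → V H × V H → Set
  Incident p (a , b) = a ≡ p ⊎ b ≡ p

  ∈-L⁻ : ∀ {e} → e ∈ verts (L H) → e ∈ pairs (verts H) × adj H (proj₁ e) (proj₂ e) ≡ true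
  ∈-L⁻ e∈ = Product.map₂ (Equivalence.to T-≡) (∈-filter⁻ (T? ∘ uncurry (adj H)) {xs = pairs (verts H)} e∈)

  ∈-L⁺ : ∀ {e} → e ∈ pairs (verts H) → adj H (proj₁ e) (proj₂ e) ≡ true → e ∈ verts (L H)
  ∈-L⁺ e∈ adj≡true = ∈-filter⁺ (T? ∘ uncurry (adj H)) e∈ (Equivalence.from T-≡ adj≡true)

  incident-∈ : ∀ {e p} → e ∈ verts (L H) → Incident p e → p ∈ verts H
  incident-∈ e∈ (inj₁ refl) = proj₁ (∈-pairs⁻ (proj₁ (∈-L⁻ e∈)))
  incident-∈ e∈ (inj₂ refl) = proj₂ (∈-pairs⁻ (proj₁ (∈-L⁻ e∈)))

  module _ {B : Set} (κ : V H → B) (κ-edge : ∀ {u v} → u ∈ verts H → v ∈ verts H → adj H u v ≡ true → κ u ≡ κ v) where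

    private
      κ-incident : ∀ {g p} → g ∈ verts (L H) → Incident p g → κ (proj₁ g) ≡ κ p
      κ-incident g∈ (inj₁ refl) = refl
      κ-incident g∈ (inj₂ refl) = let a∈ , b∈ = ∈-pairs⁻ (proj₁ (∈-L⁻ g∈)) in κ-edge a∈ b∈ (proj₂ (∈-L⁻ g∈))

      meet-κ : ∀ {e f} → e ∈ verts (L H) → f ∈ verts (L H) → Meet e f → κ (proj₁ e) ≡ κ (proj₁ f)
      meet-κ e∈ f∈ (inj₁ a≡c)               = cong κ a≡c
      meet-κ e∈ f∈ (inj₂ (inj₁ a≡d))        = sym (κ-incident f∈ (inj₂ (sym a≡d)))
      meet-κ e∈ f∈ (inj₂ (inj₂ (inj₁ b≡c))) = κ-incident e∈ (inj₂ b≡c)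
      meet-κ e∈ f∈ (inj₂ (inj₂ (inj₂ b≡d))) = trans (κ-incident e∈ (inj₂ b≡d)) (sym (κ-incident f∈ (inj₂ refl)))

      along : ∀ {e f} → e ∈ verts (L H) → Reachable (L H) e f → κ (proj₁ e) ≡ κ (proj₁ f)
      along e∈ here = refl
      along {e} e∈ (step {w = g} e~g g∈ r) = trans (meet-κ e∈ g∈ (lineAdj⇒Meet (_≟V_ H) e g e~g)) (along g∈ r)

    L-invariant : ∀ {e f p q} → e ∈ verts (L H) → f ∈ verts (L H) → Reachable (L H) e f
                → Incident p e → Incident q f → κ p ≡ κ q
    L-invariant e∈ f∈ r pe qf = trans (sym (κ-incident e∈ pe)) (trans (along e∈ r) (κ-incident f∈ qf))

  module _ (adj-sym : ∀ a b → adj H a b ≡ adj H b a) (adj-irrefl : ∀ a → adj H a a ≡ false)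
           (unique : Unique (verts H)) where

    edge-through : ∀ {u w} → u ∈ verts H → w ∈ verts H → adj H u w ≡ true
                 → Σ (V H × V H) λ e → e ∈ verts (L H) × Incident u e × Incident w e
    edge-through {u} {w} u∈ w∈ u~w with ∈-pairs⁺ u∈ w∈ (adj⇒≢ {H} adj-irrefl u~w)
    ... | inj₁ uw∈ = (u , w) , ∈-L⁺ uw∈ u~w , inj₁ refl , inj₂ refl
    ... | inj₂ wu∈ = (w , u) , ∈-L⁺ wu∈ (trans (adj-sym w u) u~w) , inj₂ refl , inj₁ refl

    incident-reachable : ∀ {e f p} → e ∈ verts (L H) → f ∈ verts (L H) → Incident p e → Incident p f
                       → Reachable (L H) e f
    incident-reachable {e} {f} e∈ f∈ pe pf with _≟V_ (L H) e f
    ... | yes refl = here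
    ... | no  e≢f  = step (Meet⇒lineAdj (_≟V_ H) e f e≢f swap-e≢f (meet pe pf)) f∈ here
      where
      swap-e≢f : swap e ≢ f
      swap-e≢f refl = pairs-asym unique (proj₁ (∈-L⁻ e∈)) (proj₁ (∈-L⁻ f∈))
      meet : ∀ {p a b c d} → Incident p (a , b) → Incident p (c , d) → Meet (a , b) (c , d)
      meet (inj₁ refl) (inj₁ c≡p) = inj₁ (sym c≡p)
      meet (inj₁ refl) (inj₂ d≡p) = inj₂ (inj₁ (sym d≡p))
      meet (inj₂ refl) (inj₁ c≡p) = inj₂ (inj₂ (inj₁ (sym c≡p)))
      meet (inj₂ refl) (inj₂ d≡p) = inj₂ (inj₂ (inj₂ (sym d≡p)))

    walk⇒L-walk : ∀ {p q e f} → Reachable H p q → e ∈ verts (L H) → f ∈ verts (L H)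
                → Incident p e → Incident q f → Reachable (L H) e f
    walk⇒L-walk here e∈ f∈ pe qf = incident-reachable e∈ f∈ pe qf
    walk⇒L-walk (step p~w w∈ r) e∈ f∈ pe qf with edge-through (incident-∈ e∈ pe) w∈ p~w
    ... | g , g∈ , pg , wg = Reachable-trans (incident-reachable e∈ g∈ pe pg) (walk⇒L-walk r g∈ f∈ wg qf)

    L-connected : (∀ u v → u ∈ verts H → v ∈ verts H → Reachable H u v) → (∃ λ e → e ∈ verts (L H))
                → Connected (L H)
    L-connected reach edge = edge , λ e f e∈ f∈ →
      walk⇒L-walk (reach _ _ (incident-∈ e∈ (inj₁ refl)) (incident-∈ f∈ (inj₁ refl))) e∈ f∈ (inj₁ refl) (inj₁ refl)

module _ (G : Graph) (adj-sym : ∀ a b → adj G a b ≡ adj G b a) (unique : Unique (verts G)) where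

  private
    edge-through″ : ∀ {u w} → u ∈ verts (G ″) → w ∈ verts (G ″) → adj (G ″) u w ≡ true
                  → Σ ((V G × Bool) × (V G × Bool)) λ e →
                      e ∈ verts (L (G ″)) × Incident (G ″) u e × Incident (G ″) w e
    edge-through″ = edge-through (G ″) (″-adj-sym G adj-sym) (″-adj-irrefl G) (″-unique G unique)

    ∈″⇒∈ : ∀ {x s} → (x , s) ∈ verts (G ″) → x ∈ verts G
    ∈″⇒∈ p∈ = proj₁ (∈-cartesianProduct⁻ (verts G) 𝔹s p∈)

    flip : V G × Bool → V G × Bool
    flip (x , s) = x , not s

    flipped-edge : ∀ {e} → e ∈ verts (L (G ″))
                 → Σ ((V G × Bool) × (V G × Bool)) λ e′ → e′ ∈ verts (L (G ″)) × Incident (G ″) (flip (proj₁ e)) e′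
    flipped-edge {(x , s) , (y , t)} e∈ =
      let e′ , e′∈ , incident , _ = edge-through″ (flip-∈ x∈) (flip-∈ y∈) (trans flip-adj (proj₂ (∈-L⁻ (G ″) e∈)))
      in e′ , e′∈ , incident
      where
      x∈ : (x , s) ∈ verts (G ″)
      x∈ = proj₁ (∈-pairs⁻ (proj₁ (∈-L⁻ (G ″) e∈)))
      y∈ : (y , t) ∈ verts (G ″)
      y∈ = proj₂ (∈-pairs⁻ (proj₁ (∈-L⁻ (G ″) e∈)))
      flip-∈ : ∀ {p} → p ∈ verts (G ″) → flip p ∈ verts (G ″)
      flip-∈ p∈ = ∈-cartesianProduct⁺ (∈″⇒∈ p∈) (∈-𝔹s _)
      flip-adj : adj (G ″) (x , not s) (y , not t) ≡ adj (G ″) (x , s) (y , t)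
      flip-adj = cong (adj G x y ∧_) (trans (not-xor-swap s (not t)) (cong (s xor_) (not-involutive t)))

  bipartite⇒¬Connected-L″ : Bipartite G → ¬ Connected (L (G ″))
  bipartite⇒¬Connected-L″ (c , proper) ((e₀ , e₀∈) , connected) =
    let e₁ , e₁∈ , flipped∈e₁ = flipped-edge e₀∈
    in not-¬ refl (trans (L-invariant (G ″) κ κ-edge e₀∈ e₁∈ (connected e₀ e₁ e₀∈ e₁∈) (inj₁ refl) flipped∈e₁)
                         (sym (not-distribʳ-xor (c (proj₁ (proj₁ e₀))) (proj₂ (proj₁ e₀)))))
    where
    κ : V G × Bool → Bool
    κ (x , s) = c x xor s
    κ-edge : ∀ {u v} → u ∈ verts (G ″) → v ∈ verts (G ″) → adj (G ″) u v ≡ true → κ u ≡ κ v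
    κ-edge {x , s} {y , t} u∈ v∈ u~v = begin
      c x xor s           ≡⟨ cong (_xor s) (¬-not (proper x y (∈″⇒∈ u∈) (∈″⇒∈ v∈) (∧-conicalˡ _ _ u~v))) ⟩
      not (c y) xor s     ≡⟨ not-xor-swap (c y) s ⟩
      c y xor not s       ≡⟨ cong (c y xor_) (xor≡true⇒ s t (∧-conicalʳ _ _ u~v)) ⟩
      c y xor t           ∎
      where
      open ≡-Reasoning
      xor≡true⇒ : ∀ s t → s xor t ≡ true → not s ≡ t
      xor≡true⇒ false t eq = sym eq
      xor≡true⇒ true  t eq = trans (cong not (sym eq)) (not-involutive t)

  ¬Connected-L″⇒bipartite : Connected G → ¬ Connected (L (G ″)) → Bipartite G
  ¬Connected-L″⇒bipartite ((v₀ , v₀∈) , reach) disconnected = colour , proper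
    where
    open DecMembership (_≟V_ G) using (_∈?_)

    R : V G × Bool → Set
    R z = Reachable (G ″) (v₀ , false) z

    v₀∈″ : (v₀ , false) ∈ verts (G ″)
    v₀∈″ = ∈-cartesianProduct⁺ v₀∈ (∈-𝔹s false)

    walk : ∀ {x} → x ∈ verts G → Reachable G v₀ x
    walk x∈ = reach v₀ _ v₀∈ x∈

    odd⇒connected : R (v₀ , true) → Connected (L (G ″))
    odd⇒connected odd@(step v₀~w w∈ _) = L-connected (G ″) (″-adj-sym G adj-sym) (″-adj-irrefl G) (″-unique G unique)
      (λ p q p∈ q∈ → Reachable-trans (Reachable-sym (″-adj-sym G adj-sym) v₀∈″ (R-all p∈)) (R-all q∈))
      (let e , e∈ , _ = edge-through″ v₀∈″ w∈ v₀~w in e , e∈)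
      where
      from-v₀ : ∀ s → R (v₀ , s)
      from-v₀ false = here
      from-v₀ true  = odd
      R-all : ∀ {p} → p ∈ verts (G ″) → R p
      R-all {x , t} p∈ =
        subst (λ u → R (x , u)) cancel (Reachable-trans (from-v₀ (t xor b)) (lift-walk G w (t xor b)))
        where
        w : Reachable G v₀ x
        w = walk (∈″⇒∈ p∈)
        b : Bool
        b = parity w
        cancel : (t xor b) xor b ≡ t
        cancel = trans (xor-assoc t b b) (trans (cong (t xor_) (xor-same b)) (xor-identityʳ t))

    walk-back : ∀ {x} → x ∈ verts G → Reachable G x v₀
    walk-back x∈ = reach _ v₀ x∈ v₀∈

    both-copies⇒odd : ∀ {v b} → v ∈ verts G → R (v , b) → R (v , not b) → R (v₀ , true)
    both-copies⇒odd {v} {b} v∈ R-b R-not-b with b xor parity (walk-back v∈) in eq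
    ... | true  = subst (λ t → R (v₀ , t)) eq (Reachable-trans R-b (lift-walk G (walk-back v∈) b))
    ... | false = subst (λ t → R (v₀ , t)) (trans (sym (not-distribˡ-xor b (parity (walk-back v∈)))) (cong not eq))
                        (Reachable-trans R-not-b (lift-walk G (walk-back v∈) (not b)))

    -- The colour of a vertex outside verts G is never inspected.
    colour : V G → Bool
    colour x with x ∈? verts G
    ... | yes x∈ = parity (walk x∈)
    ... | no  _  = false

    R-colour : ∀ {x} → x ∈ verts G → R (x , colour x)
    R-colour {x} x∈ with x ∈? verts G
    ... | yes x∈′ = lift-walk G (walk x∈′) false
    ... | no  x∉  = contradiction x∈ x∉

    proper : ∀ u v → u ∈ verts G → v ∈ verts G → adj G u v ≡ true → colour u ≢ colour v
    proper u v u∈ v∈ u~v cu≡cv = disconnected (odd⇒connected (both-copies⇒odd v∈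
      (subst (λ b → R (v , b)) (sym cu≡cv) (R-colour v∈))
      (Reachable-trans (R-colour u∈) (step (″-step G u~v (colour u)) (∈-cartesianProduct⁺ v∈ (∈-𝔹s _)) here))))

proposition3p2 : (n : ℕ) (a : Fin n → Fin n → Bool)
    → (∀ i j → a i j ≡ a j i)
    → (∀ i → a i i ≡ false)
    → Connected (finGraph n a)
    → ((¬ Connected (L (finGraph n a ″))) ⇔ Bipartite (finGraph n a))
    × (2 * triangles (L (finGraph n a)) ≡ triangles (γ (finGraph n a)) + triangles (L (finGraph n a ″)))
proposition3p2 n a a-sym a-irrefl connected =
  mk⇔ (¬Connected-L″⇒bipartite X a-sym (allFin⁺ n) connected) (bipartite⇒¬Connected-L″ X a-sym (allFin⁺ n)) ,
  2*triangles-L≡triangles-γ+triangles-L″ X a-sym a-irrefl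
  where
  X : Graph
  X = finGraph n a
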